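{- Let $L$ be a finite distributive lattice, let $J(L)$ be its poset of join-irreducible elements, and fix a partition of $J(L)$ into $n$ chains $C_1,\dots,C_n$. For $G\in L$ and $1\le r\le n$, let $G[r]$ denote the number of elements of $C_r$ that lie in the order ideal of $J(L)$ corresponding to $G$. Let $B$ be a regular boolean predicate on $L$. Let $M=\{M_1,\dots,M_k\}\subseteq L$ be a set of $k$ elements, each of which satisfies $B$. For each $j$ with $1\le j\le k$, let $G^j$ be the element of $L$ determined by the requirement that, for every $r\in\{1,\dots,n\}$, $G^j[r]$ is the $j$-th element of the multiset $\{M_i[r] : 1\le i\le k\}$ sorted in nondecreasing order. Then $G^j$ satisfies $B$.
   Context: By Birkhoff's representation theorem, the map sending $G\in L$ to the order ideal $\{x\in J(L): x\le G\}$ of $J(L)$ is a bijection between $L$ and the order ideals (down-closed subsets) of $J(L)$; this is the order ideal "corresponding to $G$". A boolean predicate $B$ on $L$ is called regular if the set of elements of $L$ satisfying $B$ is a sublattice of $L$, i.e., whenever $G$ and $H$ satisfy $B$, so do $G\sqcup H$ and $G\sqcap H$ (join and meet in $L$). -}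

module Defs where

open import Level using (0ℓ)
open import Data.Nat using (ℕ; zero; suc)
open import Data.Nat.Properties using (≤-decTotalOrder)
open import Data.Fin using (Fin; zero; suc)
open import Data.Fin.Properties using (_≟_; all?)
open import Data.List using (List; []; _∷_; length; filter; map; allFin)
open import Data.Product using (_×_; Σ)
open import Data.Sum using (_⊎_)
open import Data.Bool using (Bool; true)
open import Relation.Nullary using (¬_; Dec; ¬?)
open import Relation.Nullary.Decidable using (_×-dec_; _⊎-dec_; _→-dec_)
open import Relation.Binary.PropositionalEquality using (_≡_)
open import Algebra.Core using (Op₂)
open import Algebra.Lattice.Structures using (IsDistributiveLattice)
import Data.List.Sort as S

-- A finite distributive lattice, presented (up to isomorphism) on the
-- carrier Fin m with propositional equality; ∨ is join (⊔), ∧ is meet (⊓).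
record FinDistLattice : Set where
  field
    m      : ℕ
    _∨_    : Op₂ (Fin m)
    _∧_    : Op₂ (Fin m)
    isDistributiveLattice : IsDistributiveLattice _≡_ _∨_ _∧_

module FDL (L : FinDistLattice) where
  open FinDistLattice L public

  Elt : Set
  Elt = Fin m

  _≤_ : Elt → Elt → Set
  x ≤ y = (x ∨ y) ≡ y

  _≤?_ : (x y : Elt) → Dec (x ≤ y)
  x ≤? y = (x ∨ y) ≟ y

  JoinIrr : Elt → Set
  JoinIrr x = (¬ (∀ y → x ≤ y)) × (∀ a b → (a ∨ b) ≡ x → (a ≡ x) ⊎ (b ≡ x))

  joinIrr? : (x : Elt) → Dec (JoinIrr x)
  joinIrr? x = ¬? (all? (λ y → x ≤? y))
         ×-dec all? (λ a → all? (λ b → ((a ∨ b) ≟ x) →-dec ((a ≟ x) ⊎-dec (b ≟ x))))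

  -- A partition of J(L) into n chains C_1..C_n, given by the chain index
  -- `chain x` of each join-irreducible x (values on other elements are irrelevant).
  record ChainPartition (n : ℕ) : Set where
    field
      chain    : Elt → Fin n
      isChain  : ∀ x y → JoinIrr x → JoinIrr y → chain x ≡ chain y → (x ≤ y) ⊎ (y ≤ x)
      nonempty : ∀ r → Σ Elt (λ x → JoinIrr x × chain x ≡ r)

  coord : ∀ {n} → ChainPartition n → Elt → Fin n → ℕ
  coord P G r = length (filter (λ x → joinIrr? x ×-dec ((chain x ≟ r) ×-dec (x ≤? G))) (allFin m))
    where open ChainPartition P

  Regular : (Elt → Bool) → Set
  Regular B = ∀ G H → B G ≡ true → B H ≡ true → (B (G ∨ H) ≡ true) × (B (G ∧ H) ≡ true)

sortℕ : List ℕ → List ℕ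
sortℕ = S.sort ≤-decTotalOrder

-- j-th element (0-based) of a list; default 0 out of range (never used out of range below)
nth : List ℕ → ℕ → ℕ
nth []       _       = 0
nth (x ∷ xs) zero    = x
nth (x ∷ xs) (suc j) = nth xs j

module Submission where

-- The chain coordinates
-- G ↦ (G[1], ..., G[n]) form an injective lattice homomorphism from L into
-- (ℕⁿ, max, min): the join-irreducibles of a chain below G form a segment
-- of that chain, segments below two elements are nested, and since
-- join-irreducibles are join-prime the segment below G ⊔ H is the union
-- (the larger) and the one below G ⊓ H the intersection (the smaller).
-- Injectivity is Birkhoff's separation: if G ⋢ H, a join-irreducible lies
-- below G but not below H.
--
-- Inserting an entry y into a sorted list s yields the order statistics
-- y ⊓ s[0], then s[j] ⊔ (y ⊓ s[j+1]), and s[last] ⊔ y at the end.  So for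
-- any coordinates that are lattice homomorphisms into (ℕ, ⊔, ⊓) the
-- coordinatewise j-th order statistic of elements of a sublattice is
-- realised by a lattice polynomial in them, hence inside the sublattice
-- (OrderStatistics.realise).  The theorem combines this with injectivity.

open import Defs
open import Level using (0ℓ)
open import Data.Bool using (Bool; true; false)
open import Data.Unit using (tt)
open import Data.Empty using (⊥-elim)
open import Data.Nat using (ℕ; zero; suc; _≤_; _<_; _⊔_; _⊓_; _≤ᵇ_; _≤?_; s≤s; z≤n)
open import Data.Nat.Properties
  using ( ≤-refl; ≤-trans; ≤-reflexive; <⇒≤; n<1+n; <-trans; ≰⇒>; ≤∧≢⇒<; <⇒≱
        ; m≤n⇒m<n∨m≡n; ≤⇒≤ᵇ; ≤ᵇ⇒≤; m≤n⇒m⊔n≡n; m≥n⇒m⊔n≡m; m≤n⇒m⊓n≡m; m≥n⇒m⊓n≡n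
        ; m⊓n≤m; ⊓-glb; suc-injective; ≤-totalOrder; ≤-decTotalOrder )
open import Data.Nat.Induction using (<-wellFounded)
open import Data.Fin using (Fin; toℕ)
open import Data.Fin.Properties using (¬∀⟶∃¬; all?; toℕ<n) renaming (_≟_ to _≟ᶠ_)
open import Data.List using (List; []; _∷_; length; filter; map; allFin)
open import Data.List.Properties using (filter-≐; length-map; length-tabulate; map-∘)
open import Data.List.Membership.Propositional using (_∈_)
open import Data.List.Membership.Propositional.Properties using (∈-allFin; ∈-filter⁺; ∈-filter⁻)
open import Data.List.Relation.Unary.All using (All; []; _∷_)
open import Data.List.Relation.Unary.All.Properties using (map⁺; tabulate⁺)
open import Data.List.Relation.Unary.Linked using ([-]; _∷_)
open import Data.List.Relation.Unary.Sorted.TotalOrder ≤-totalOrder using (Sorted)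
open import Data.List.Relation.Unary.Sorted.TotalOrder.Properties using (↗↭↗⇒≋)
open import Data.List.Relation.Binary.Pointwise using (Pointwise-≡⇒≡)
open import Data.List.Relation.Binary.Sublist.Propositional using (⊆-refl) renaming (_⊆_ to _⊑ₗ_)
open import Data.List.Relation.Binary.Sublist.Propositional.Properties
  using (filter⁺; length-mono-≤; to-≋)
open import Data.List.Relation.Binary.Permutation.Propositional
  using (_↭_; ↭⇒↭ₛ; ↭-trans; ↭-sym; ↭-prep)
open import Data.List.Relation.Binary.Permutation.Propositional.Properties using (↭-length)
import Data.List.Sort as Sort
open import Data.List.Sort.InsertionSort.Base ≤-decTotalOrder using (insert)
open import Data.List.Sort.InsertionSort.Properties ≤-decTotalOrder using (insert-↭; insert-↗)
open import Data.Product using (Σ; _×_; _,_; proj₁; proj₂)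
open import Data.Sum using (_⊎_; inj₁; inj₂; [_,_])
import Data.Sum as Sum
open import Function using (_∘_; id; _on_)
open import Function.Definitions using (Injective)
open import Induction.WellFounded using (Acc; acc)
import Relation.Binary.Construct.On as On
open import Relation.Nullary using (¬_; Dec; yes; no; contradiction)
open import Relation.Nullary.Decidable using (_×-dec_; _⊎-dec_; _→-dec_)
open import Relation.Unary using (Pred; Decidable; _⊆_; _≐_; _∪_; _∩_)
open import Relation.Binary.PropositionalEquality using (_≡_; _≢_; refl; sym; trans; cong; cong₂; subst; module ≡-Reasoning)
open import Algebra.Core using (Op₂)
open import Algebra.Lattice.Bundles using (Lattice)
open import Algebra.Lattice.Structures using (IsDistributiveLattice)
import Algebra.Lattice.Properties.Lattice as LatticeProperties
open import Relation.Binary.Lattice.Structures using (module IsLattice)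

refute-→ : {P Q : Set} → Dec P → ¬ (P → Q) → P × ¬ Q
refute-→ (yes p) ¬p→q = p , λ q → ¬p→q (λ _ → q)
refute-→ (no ¬p) ¬p→q = contradiction (λ p → ⊥-elim (¬p p)) ¬p→q

count : {A : Set} {R : Pred A 0ℓ} → Decidable R → List A → ℕ
count R? xs = length (filter R? xs)

module _ {A : Set} {P Q : Pred A 0ℓ} (P? : Decidable P) (Q? : Decidable Q) (P⊆Q : P ⊆ Q) where

  filter-sublist : ∀ xs → filter P? xs ⊑ₗ filter Q? xs
  filter-sublist xs = filter⁺ P? Q? (λ { refl → P⊆Q }) (⊆-refl {x = xs})

  count-mono : ∀ xs → count P? xs ≤ count Q? xs
  count-mono xs = length-mono-≤ (filter-sublist xs)

  count-strict : ∀ {y} xs → y ∈ xs → Q y → ¬ P y → count P? xs < count Q? xs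
  count-strict xs y∈xs Qy ¬Py = ≤∧≢⇒< (count-mono xs) counts-differ
    where
    counts-differ : ¬ count P? xs ≡ count Q? xs
    counts-differ eq = ¬Py (proj₂ (∈-filter⁻ P? {xs = xs} y∈filterP))
      where
      filterP≡filterQ : filter P? xs ≡ filter Q? xs
      filterP≡filterQ = Pointwise-≡⇒≡ (to-≋ {as = filter P? xs} eq (filter-sublist xs))
      y∈filterP : _ ∈ filter P? xs
      y∈filterP = subst (_ ∈_) (sym filterP≡filterQ) (∈-filter⁺ Q? y∈xs Qy)

count-cong : {A : Set} {P Q : Pred A 0ℓ} (P? : Decidable P) (Q? : Decidable Q) →
             P ≐ Q → ∀ xs → count P? xs ≡ count Q? xs
count-cong P? Q? P≐Q xs = cong length (filter-≐ P? Q? P≐Q xs)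

module _ {A : Set} {P Q R : Pred A 0ℓ} (P? : Decidable P) (Q? : Decidable Q) (R? : Decidable R) where
  open ≡-Reasoning

  count-∪ : R ≐ P ∪ Q → P ⊆ Q ⊎ Q ⊆ P → ∀ xs → count R? xs ≡ count P? xs ⊔ count Q? xs
  count-∪ (R⊆P∪Q , P∪Q⊆R) (inj₁ P⊆Q) xs = begin
    count R? xs                ≡⟨ count-cong R? Q? ((λ r → [ P⊆Q , id ] (R⊆P∪Q r)) , (λ q → P∪Q⊆R (inj₂ q))) xs ⟩
    count Q? xs                ≡⟨ m≤n⇒m⊔n≡n (count-mono P? Q? P⊆Q xs) ⟨
    count P? xs ⊔ count Q? xs  ∎
  count-∪ (R⊆P∪Q , P∪Q⊆R) (inj₂ Q⊆P) xs = begin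
    count R? xs                ≡⟨ count-cong R? P? ((λ r → [ id , Q⊆P ] (R⊆P∪Q r)) , (λ p → P∪Q⊆R (inj₁ p))) xs ⟩
    count P? xs                ≡⟨ m≥n⇒m⊔n≡m (count-mono Q? P? Q⊆P xs) ⟨
    count P? xs ⊔ count Q? xs  ∎

  count-∩ : R ≐ P ∩ Q → P ⊆ Q ⊎ Q ⊆ P → ∀ xs → count R? xs ≡ count P? xs ⊓ count Q? xs
  count-∩ (R⊆P∩Q , P∩Q⊆R) (inj₁ P⊆Q) xs = begin
    count R? xs                ≡⟨ count-cong R? P? ((λ r → proj₁ (R⊆P∩Q r)) , (λ p → P∩Q⊆R (p , P⊆Q p))) xs ⟩
    count P? xs                ≡⟨ m≤n⇒m⊓n≡m (count-mono P? Q? P⊆Q xs) ⟨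
    count P? xs ⊓ count Q? xs  ∎
  count-∩ (R⊆P∩Q , P∩Q⊆R) (inj₂ Q⊆P) xs = begin
    count R? xs                ≡⟨ count-cong R? Q? ((λ r → proj₂ (R⊆P∩Q r)) , (λ q → P∩Q⊆R (Q⊆P q , q))) xs ⟩
    count Q? xs                ≡⟨ m≥n⇒m⊓n≡n (count-mono Q? P? Q⊆P xs) ⟨
    count P? xs ⊓ count Q? xs  ∎

sorted-↭-unique : ∀ {xs ys} → Sorted xs → Sorted ys → xs ↭ ys → xs ≡ ys
sorted-↭-unique xs↗ ys↗ xs↭ys = Pointwise-≡⇒≡ (↗↭↗⇒≋ ≤-totalOrder xs↗ ys↗ (↭⇒↭ₛ xs↭ys))

sortℕ-↗ : ∀ l → Sorted (sortℕ l)
sortℕ-↗ = Sort.sort-↗ ≤-decTotalOrder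

sortℕ-↭ : ∀ l → sortℕ l ↭ l
sortℕ-↭ = Sort.sort-↭ ≤-decTotalOrder

length-sortℕ : ∀ l → length (sortℕ l) ≡ length l
length-sortℕ l = ↭-length (sortℕ-↭ l)

-- sortℕ agrees with insertion sort: it inserts the head into the sorted
-- tail (both sides are sorted permutations of y ∷ l)
sortℕ-cons : ∀ y l → sortℕ (y ∷ l) ≡ insert y (sortℕ l)
sortℕ-cons y l = sorted-↭-unique (sortℕ-↗ (y ∷ l)) (insert-↗ y (sortℕ-↗ l))
  (↭-trans (sortℕ-↭ (y ∷ l)) (↭-sym (↭-trans (insert-↭ y (sortℕ l)) (↭-prep y (sortℕ-↭ l)))))

sortℕ-singleton : ∀ y → sortℕ (y ∷ []) ≡ y ∷ []
sortℕ-singleton y = sorted-↭-unique (sortℕ-↗ (y ∷ [])) [-] (sortℕ-↭ (y ∷ []))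

insert-≤ : ∀ {y a} s → y ≤ a → insert y (a ∷ s) ≡ y ∷ a ∷ s
insert-≤ {y} {a} s y≤a with y ≤ᵇ a | ≤⇒≤ᵇ y≤a
... | true | _ = refl

insert-> : ∀ {y a} s → a < y → insert y (a ∷ s) ≡ a ∷ insert y s
insert-> {y} {a} s a<y with y ≤ᵇ a | ≤ᵇ⇒≤ y a
... | true  | y≤a = contradiction (y≤a tt) (<⇒≱ a<y)
... | false | _   = refl

sorted-head≤ : ∀ {a s} j → Sorted (a ∷ s) → j < length (a ∷ s) → a ≤ nth (a ∷ s) j
sorted-head≤ zero _ _ = ≤-refl
sorted-head≤ {s = _ ∷ _} (suc j) (a≤b ∷ b∷s↗) (s≤s j<n) = ≤-trans a≤b (sorted-head≤ j b∷s↗ j<n)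

-- Order statistics of  insert y s  for sorted s, in terms of those of s:
-- the new j-th entry is the median of  s[j-1], y, s[j].
nth-insert-zero : ∀ y {s} → 0 < length s → nth (insert y s) 0 ≡ y ⊓ nth s 0
nth-insert-zero y {a ∷ s} _ with y ≤? a
... | yes y≤a rewrite insert-≤ s y≤a = sym (m≤n⇒m⊓n≡m y≤a)
... | no  y≰a rewrite insert-> s (≰⇒> y≰a) = sym (m≥n⇒m⊓n≡n (<⇒≤ (≰⇒> y≰a)))

nth-insert-suc : ∀ y {s} j → Sorted s → suc j < length s →
                 nth (insert y s) (suc j) ≡ nth s j ⊔ (y ⊓ nth s (suc j))
nth-insert-suc y {a ∷ s} j s↗ j+1<n with y ≤? a
... | yes y≤a rewrite insert-≤ s y≤a =
  sym (m≥n⇒m⊔n≡m (≤-trans (m⊓n≤m y _) (≤-trans y≤a (sorted-head≤ j s↗ (<-trans (n<1+n _) j+1<n)))))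
nth-insert-suc y {a ∷ b ∷ s} zero (a≤b ∷ _) _ | no y≰a rewrite insert-> (b ∷ s) (≰⇒> y≰a) =
  trans (nth-insert-zero y {b ∷ s} (s≤s z≤n)) (sym (m≤n⇒m⊔n≡n (⊓-glb (<⇒≤ (≰⇒> y≰a)) a≤b)))
nth-insert-suc y {a ∷ b ∷ s} (suc j) (_ ∷ b∷s↗) (s≤s j+1<n) | no y≰a rewrite insert-> (b ∷ s) (≰⇒> y≰a) =
  nth-insert-suc y j b∷s↗ j+1<n
nth-insert-suc y {a ∷ []} zero _ (s≤s ()) | no _

nth-insert-last : ∀ y {s} j → Sorted s → suc j ≡ length s → nth (insert y s) (suc j) ≡ nth s j ⊔ y
nth-insert-last y {a ∷ s} j s↗ j+1≡n with y ≤? a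
... | yes y≤a rewrite insert-≤ s y≤a = sym (m≥n⇒m⊔n≡m (≤-trans y≤a (sorted-head≤ j s↗ (≤-reflexive j+1≡n))))
nth-insert-last y {a ∷ []} zero _ _ | no y≰a rewrite insert-> [] (≰⇒> y≰a) = sym (m≤n⇒m⊔n≡n (<⇒≤ (≰⇒> y≰a)))
nth-insert-last y {a ∷ b ∷ s} (suc j) (_ ∷ b∷s↗) j+1≡n | no y≰a rewrite insert-> (b ∷ s) (≰⇒> y≰a) =
  nth-insert-last y j b∷s↗ (suc-injective j+1≡n)

module _ (y : ℕ) (l : List ℕ) where

  private
    nth-sortℕ-cons : ∀ j → nth (sortℕ (y ∷ l)) j ≡ nth (insert y (sortℕ l)) j
    nth-sortℕ-cons j = cong (λ s → nth s j) (sortℕ-cons y l)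

    sortℕ-<-length : ∀ {i} → i < length l → i < length (sortℕ l)
    sortℕ-<-length = subst (_ <_) (sym (length-sortℕ l))

  nth-sortℕ-zero : 0 < length l → nth (sortℕ (y ∷ l)) 0 ≡ y ⊓ nth (sortℕ l) 0
  nth-sortℕ-zero 0<n = trans (nth-sortℕ-cons 0) (nth-insert-zero y {sortℕ l} (sortℕ-<-length 0<n))

  nth-sortℕ-suc : ∀ j → suc j < length l →
                  nth (sortℕ (y ∷ l)) (suc j) ≡ nth (sortℕ l) j ⊔ (y ⊓ nth (sortℕ l) (suc j))
  nth-sortℕ-suc j j+1<n =
    trans (nth-sortℕ-cons (suc j)) (nth-insert-suc y {sortℕ l} j (sortℕ-↗ l) (sortℕ-<-length j+1<n))

  nth-sortℕ-last : ∀ j → suc j ≡ length l → nth (sortℕ (y ∷ l)) (suc j) ≡ nth (sortℕ l) j ⊔ y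
  nth-sortℕ-last j j+1≡n =
    trans (nth-sortℕ-cons (suc j)) (nth-insert-last y {sortℕ l} j (sortℕ-↗ l) (trans j+1≡n (sym (length-sortℕ l))))

nth-sortℕ-singleton : ∀ y → nth (sortℕ (y ∷ [])) 0 ≡ y
nth-sortℕ-singleton y = cong (λ s → nth s 0) (sortℕ-singleton y)

module OrderStatistics
  {A I : Set} (_∨_ _∧_ : Op₂ A) (c : A → I → ℕ)
  (c-∨ : ∀ G H r → c (G ∨ H) r ≡ c G r ⊔ c H r)
  (c-∧ : ∀ G H r → c (G ∧ H) r ≡ c G r ⊓ c H r)
  (S : Pred A 0ℓ) (S-∨ : ∀ {G H} → S G → S H → S (G ∨ H)) (S-∧ : ∀ {G H} → S G → S H → S (G ∧ H))
  where
  open ≡-Reasoning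

  coords : List A → I → List ℕ
  coords Ms r = map (λ G → c G r) Ms

  stat : List A → ℕ → I → ℕ
  stat Ms j r = nth (sortℕ (coords Ms r)) j

  Realises : List A → ℕ → A → Set
  Realises Ms j G = S G × (∀ r → c G r ≡ stat Ms j r)

  -- Induction on the list, following the recurrences for inserting the
  -- head x:  stat 0 = x ∧ G₀,  stat (j+1) = G_j ∨ (x ∧ G_{j+1}),
  -- and at the last position  stat (j+1) = G_j ∨ x.
  realise : ∀ Ms → All S Ms → ∀ j → j < length Ms → Σ A (Realises Ms j)
  realise (x ∷ []) (Sx ∷ []) zero _ = x , Sx , λ r → sym (nth-sortℕ-singleton (c x r))
  realise (x ∷ rest@(_ ∷ _)) (Sx ∷ S-rest) zero _ =
    let G₀ , SG₀ , G₀-stat = realise rest S-rest 0 (s≤s z≤n) in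
    x ∧ G₀ , S-∧ Sx SG₀ , λ r → begin
      c (x ∧ G₀) r            ≡⟨ c-∧ x G₀ r ⟩
      c x r ⊓ c G₀ r          ≡⟨ cong (c x r ⊓_) (G₀-stat r) ⟩
      c x r ⊓ stat rest 0 r   ≡⟨ nth-sortℕ-zero (c x r) (coords rest r) (s≤s z≤n) ⟨
      stat (x ∷ rest) 0 r     ∎
  realise (x ∷ rest) (Sx ∷ S-rest) (suc j) (s≤s j<n) with m≤n⇒m<n∨m≡n j<n
  ... | inj₁ j+1<n =
    let Gⱼ , SGⱼ , Gⱼ-stat = realise rest S-rest j j<n
        Gⱼ₊₁ , SGⱼ₊₁ , Gⱼ₊₁-stat = realise rest S-rest (suc j) j+1<n in
    Gⱼ ∨ (x ∧ Gⱼ₊₁) , S-∨ SGⱼ (S-∧ Sx SGⱼ₊₁) , λ r → begin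
      c (Gⱼ ∨ (x ∧ Gⱼ₊₁)) r                            ≡⟨ c-∨ Gⱼ (x ∧ Gⱼ₊₁) r ⟩
      c Gⱼ r ⊔ c (x ∧ Gⱼ₊₁) r                          ≡⟨ cong (c Gⱼ r ⊔_) (c-∧ x Gⱼ₊₁ r) ⟩
      c Gⱼ r ⊔ (c x r ⊓ c Gⱼ₊₁ r)                      ≡⟨ cong₂ (λ a b → a ⊔ (c x r ⊓ b)) (Gⱼ-stat r) (Gⱼ₊₁-stat r) ⟩
      stat rest j r ⊔ (c x r ⊓ stat rest (suc j) r)    ≡⟨ nth-sortℕ-suc (c x r) (coords rest r) j (length-coords j+1<n) ⟨
      stat (x ∷ rest) (suc j) r                        ∎
    where
    length-coords : ∀ {i r} → i < length rest → i < length (coords rest r)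
    length-coords = subst (_ <_) (sym (length-map _ rest))
  ... | inj₂ j+1≡n =
    let Gⱼ , SGⱼ , Gⱼ-stat = realise rest S-rest j j<n in
    Gⱼ ∨ x , S-∨ SGⱼ Sx , λ r → begin
      c (Gⱼ ∨ x) r              ≡⟨ c-∨ Gⱼ x r ⟩
      c Gⱼ r ⊔ c x r            ≡⟨ cong (_⊔ c x r) (Gⱼ-stat r) ⟩
      stat rest j r ⊔ c x r     ≡⟨ nth-sortℕ-last (c x r) (coords rest r) j (trans j+1≡n (sym (length-map _ rest))) ⟨
      stat (x ∷ rest) (suc j) r ∎

module LatticeFacts (L : FinDistLattice) where
  open FDL L renaming (_≤_ to _⊑_; _≤?_ to _⊑?_)
  open IsDistributiveLattice isDistributiveLattice
    using (isLattice; ∨-comm; ∧-comm; ∨-absorbs-∧; ∧-absorbs-∨; ∧-distribˡ-∨)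
  open ≡-Reasoning

  lattice : Lattice 0ℓ 0ℓ
  lattice = record { isLattice = isLattice }

  -- the library's order-theoretic view of the lattice uses the order
  -- x ≼ y iff x ≡ x ∧ y; it is equivalent to the order ⊑ of the statement
  _≼_ : Elt → Elt → Set
  x ≼ y = x ≡ x ∧ y

  module ≼ = IsLattice (LatticeProperties.∨-∧-isOrderTheoreticLattice lattice)

  ⊑⇒≼ : ∀ {x y} → x ⊑ y → x ≼ y
  ⊑⇒≼ {x} {y} x∨y≡y = sym (begin
    x ∧ y        ≡⟨ cong (x ∧_) x∨y≡y ⟨
    x ∧ (x ∨ y)  ≡⟨ ∧-absorbs-∨ x y ⟩
    x            ∎)

  ≼⇒⊑ : ∀ {x y} → x ≼ y → x ⊑ y
  ≼⇒⊑ {x} {y} x≡x∧y = begin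
    x ∨ y        ≡⟨ cong (_∨ y) x≡x∧y ⟩
    (x ∧ y) ∨ y  ≡⟨ ∨-comm (x ∧ y) y ⟩
    y ∨ (x ∧ y)  ≡⟨ cong (y ∨_) (∧-comm x y) ⟩
    y ∨ (y ∧ x)  ≡⟨ ∨-absorbs-∧ y x ⟩
    y            ∎

  ⊑-refl : ∀ x → x ⊑ x
  ⊑-refl x = ≼⇒⊑ ≼.refl

  ⊑-trans : ∀ {x y z} → x ⊑ y → y ⊑ z → x ⊑ z
  ⊑-trans x⊑y y⊑z = ≼⇒⊑ (≼.trans (⊑⇒≼ x⊑y) (⊑⇒≼ y⊑z))

  ⊑-antisym : ∀ {x y} → x ⊑ y → y ⊑ x → x ≡ y
  ⊑-antisym x⊑y y⊑x = ≼.antisym (⊑⇒≼ x⊑y) (⊑⇒≼ y⊑x)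

  ⊑-∨ˡ : ∀ x y → x ⊑ (x ∨ y)
  ⊑-∨ˡ x y = ≼⇒⊑ (≼.x≤x∨y x y)

  ⊑-∨ʳ : ∀ x y → y ⊑ (x ∨ y)
  ⊑-∨ʳ x y = ≼⇒⊑ (≼.y≤x∨y x y)

  ∨-least : ∀ {x y z} → x ⊑ z → y ⊑ z → (x ∨ y) ⊑ z
  ∨-least x⊑z y⊑z = ≼⇒⊑ (≼.∨-least (⊑⇒≼ x⊑z) (⊑⇒≼ y⊑z))

  ∧-⊑ˡ : ∀ x y → (x ∧ y) ⊑ x
  ∧-⊑ˡ x y = ≼⇒⊑ (≼.x∧y≤x x y)

  ∧-⊑ʳ : ∀ x y → (x ∧ y) ⊑ y
  ∧-⊑ʳ x y = ≼⇒⊑ (≼.x∧y≤y x y)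

  ∧-greatest : ∀ {x y z} → x ⊑ y → x ⊑ z → x ⊑ (y ∧ z)
  ∧-greatest x⊑y x⊑z = ≼⇒⊑ (≼.∧-greatest (⊑⇒≼ x⊑y) (⊑⇒≼ x⊑z))

  -- By distributivity, join-irreducible elements are join-prime.
  joinIrr-prime : ∀ {x G H} → JoinIrr x → x ⊑ (G ∨ H) → (x ⊑ G) ⊎ (x ⊑ H)
  joinIrr-prime {x} {G} {H} (_ , irreducible) x⊑G∨H =
    Sum.map (≼⇒⊑ ∘ sym) (≼⇒⊑ ∘ sym) (irreducible (x ∧ G) (x ∧ H) x∧G∨x∧H≡x)
    where
    x∧G∨x∧H≡x : ((x ∧ G) ∨ (x ∧ H)) ≡ x
    x∧G∨x∧H≡x = begin
      (x ∧ G) ∨ (x ∧ H)  ≡⟨ ∧-distribˡ-∨ x G H ⟨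
      x ∧ (G ∨ H)        ≡⟨ ⊑⇒≼ x⊑G∨H ⟨
      x                  ∎

  below : Elt → ℕ
  below y = count (_⊑? y) (allFin m)

  below-strict : ∀ {a y} → a ⊑ y → a ≢ y → below a < below y
  below-strict {a} {y} a⊑y a≢y =
    count-strict (_⊑? a) (_⊑? y) (λ z⊑a → ⊑-trans z⊑a a⊑y) (allFin m) (∈-allFin y) (⊑-refl y)
      (λ y⊑a → a≢y (⊑-antisym a⊑y y⊑a))

  split : ∀ y → ¬ JoinIrr y → ¬ (∀ z → y ⊑ z) →
          Σ Elt λ a → Σ Elt λ b → ((a ∨ b) ≡ y) × a ≢ y × b ≢ y
  split y ¬ji ¬least =
    let a , ¬a-irr = ¬∀⟶∃¬ m _ (λ a → all? (irreducible-at? a)) (λ irr → ¬ji (¬least , irr))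
        b , ¬ab-irr = ¬∀⟶∃¬ m _ (irreducible-at? a) ¬a-irr
        a∨b≡y , ¬a≡y⊎b≡y = refute-→ ((a ∨ b) ≟ᶠ y) ¬ab-irr
    in a , b , a∨b≡y , (λ a≡y → ¬a≡y⊎b≡y (inj₁ a≡y)) , (λ b≡y → ¬a≡y⊎b≡y (inj₂ b≡y))
    where
    irreducible-at? : ∀ a b → Dec (((a ∨ b) ≡ y) → (a ≡ y) ⊎ (b ≡ y))
    irreducible-at? a b = ((a ∨ b) ≟ᶠ y) →-dec ((a ≟ᶠ y) ⊎-dec (b ≟ᶠ y))

  -- Descend through a splitting y = a ∨ b, one of whose parts
  -- is not below H, by well-founded induction on the size of the down-set.
  module _ (H : Elt) where
    joinIrr-witness : ∀ y → Acc (_<_ on below) y → ¬ y ⊑ H →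
                      Σ Elt λ x → JoinIrr x × x ⊑ y × ¬ x ⊑ H
    joinIrr-witness y (acc smaller) y⋢H with joinIrr? y
    ... | yes ji = y , ji , ⊑-refl y , y⋢H
    ... | no ¬ji = descend (split y ¬ji (λ least → y⋢H (least H)))
      where
      through : ∀ {z} → z ⊑ y → z ≢ y → ¬ z ⊑ H → Σ Elt λ x → JoinIrr x × x ⊑ y × ¬ x ⊑ H
      through z⊑y z≢y z⋢H =
        let x , ji , x⊑z , x⋢H = joinIrr-witness _ (smaller (below-strict z⊑y z≢y)) z⋢H
        in x , ji , ⊑-trans x⊑z z⊑y , x⋢H

      descend : (Σ Elt λ a → Σ Elt λ b → ((a ∨ b) ≡ y) × a ≢ y × b ≢ y) →
                Σ Elt λ x → JoinIrr x × x ⊑ y × ¬ x ⊑ H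
      descend (a , b , a∨b≡y , a≢y , b≢y) with a ⊑? H | b ⊑? H
      ... | yes a⊑H | yes b⊑H = contradiction (subst (_⊑ H) a∨b≡y (∨-least a⊑H b⊑H)) y⋢H
      ... | no a⋢H  | _       = through (subst (a ⊑_) a∨b≡y (⊑-∨ˡ a b)) a≢y a⋢H
      ... | yes _   | no b⋢H  = through (subst (b ⊑_) a∨b≡y (⊑-∨ʳ a b)) b≢y b⋢H

  separation : ∀ {G H} → ¬ G ⊑ H → Σ Elt λ x → JoinIrr x × x ⊑ G × ¬ x ⊑ H
  separation {G} {H} G⋢H = joinIrr-witness H G (On.wellFounded below <-wellFounded G) G⋢H

  module Coordinates {n : ℕ} (P : ChainPartition n) where
    open ChainPartition P

    Segment : Fin n → Elt → Pred Elt 0ℓ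
    Segment r G x = JoinIrr x × chain x ≡ r × x ⊑ G

    segment? : ∀ r G → Decidable (Segment r G)
    segment? r G x = joinIrr? x ×-dec ((chain x ≟ᶠ r) ×-dec (x ⊑? G))

    -- The segments of a chain below two elements are nested: if x is in
    -- the first but not the second, every y of the second lies below x.
    segments-nested : ∀ r G H → Segment r G ⊆ Segment r H ⊎ Segment r H ⊆ Segment r G
    segments-nested r G H with all? (λ x → segment? r G x →-dec segment? r H x)
    ... | yes G⊆H = inj₁ (λ {x} → G⊆H x)
    ... | no G⊈H =
      let x , x-escapes = ¬∀⟶∃¬ m _ (λ x → segment? r G x →-dec segment? r H x) G⊈H
          (jx , cx , x⊑G) , x∉H = refute-→ (segment? r G x) x-escapes
          H⊆G : Segment r H ⊆ Segment r G
          H⊆G {y} (jy , cy , y⊑H) =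
            [ (λ x⊑y → contradiction (jx , cx , ⊑-trans x⊑y y⊑H) x∉H)
            , (λ y⊑x → jy , cy , ⊑-trans y⊑x x⊑G)
            ] (isChain x y jx jy (trans cx (sym cy)))
      in inj₂ H⊆G

    segment-∨ : ∀ r G H → Segment r (G ∨ H) ≐ Segment r G ∪ Segment r H
    segment-∨ r G H =
      (λ (jx , cx , x⊑G∨H) → Sum.map (λ x⊑G → jx , cx , x⊑G) (λ x⊑H → jx , cx , x⊑H) (joinIrr-prime jx x⊑G∨H)) ,
      [ (λ (jx , cx , x⊑G) → jx , cx , ⊑-trans x⊑G (⊑-∨ˡ G H))
      , (λ (jx , cx , x⊑H) → jx , cx , ⊑-trans x⊑H (⊑-∨ʳ G H)) ]

    segment-∧ : ∀ r G H → Segment r (G ∧ H) ≐ Segment r G ∩ Segment r H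
    segment-∧ r G H =
      (λ (jx , cx , x⊑G∧H) → (jx , cx , ⊑-trans x⊑G∧H (∧-⊑ˡ G H)) , (jx , cx , ⊑-trans x⊑G∧H (∧-⊑ʳ G H))) ,
      (λ ((jx , cx , x⊑G) , (_ , _ , x⊑H)) → jx , cx , ∧-greatest x⊑G x⊑H)

    coord-∨ : ∀ G H r → coord P (G ∨ H) r ≡ coord P G r ⊔ coord P H r
    coord-∨ G H r =
      count-∪ (segment? r G) (segment? r H) (segment? r (G ∨ H)) (segment-∨ r G H) (segments-nested r G H) (allFin m)

    coord-∧ : ∀ G H r → coord P (G ∧ H) r ≡ coord P G r ⊓ coord P H r
    coord-∧ G H r =
      count-∩ (segment? r G) (segment? r H) (segment? r (G ∧ H)) (segment-∧ r G H) (segments-nested r G H) (allFin m)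

    -- the coordinates reflect the order: a join-irreducible separating G
    -- from H makes the segment of its chain below H strictly smaller
    coord-reflects : ∀ {G H} → (∀ r → coord P G r ≤ coord P H r) → G ⊑ H
    coord-reflects {G} {H} G≤H with G ⊑? H
    ... | yes G⊑H = G⊑H
    ... | no G⋢H = separated (separation G⋢H)
      where
      separated : (Σ Elt λ x → JoinIrr x × x ⊑ G × ¬ x ⊑ H) → G ⊑ H
      separated (x , jx , x⊑G , x⋢H) with segments-nested (chain x) G H
      ... | inj₁ G⊆H = contradiction (proj₂ (proj₂ (G⊆H (jx , refl , x⊑G)))) x⋢H
      ... | inj₂ H⊆G = contradiction (G≤H (chain x)) (<⇒≱ H<G)
        where
        H<G : coord P H (chain x) < coord P G (chain x)
        H<G = count-strict (segment? (chain x) H) (segment? (chain x) G) H⊆G (allFin m) (∈-allFin x)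
                (jx , refl , x⊑G) (λ (_ , _ , x⊑H) → x⋢H x⊑H)

    coord-injective : ∀ {G H} → (∀ r → coord P G r ≡ coord P H r) → G ≡ H
    coord-injective G≡H = ⊑-antisym (coord-reflects (λ r → ≤-reflexive (G≡H r)))
                                     (coord-reflects (λ r → ≤-reflexive (sym (G≡H r))))

-- The theorem: the coordinatewise j-th order statistic of M_1, ..., M_k is
-- realised by an element satisfying B (realise, with B as sublattice and
-- the chain coordinates as homomorphisms), and by injectivity of the
-- coordinates every element with these coordinates is that one.
theorem2 : (L : FinDistLattice) → let open FDL L in
  (n : ℕ) (P : ChainPartition n) (B : Elt → Bool) → Regular B →
  (k : ℕ) (M : Fin k → Elt) → Injective _≡_ _≡_ M → (∀ i → B (M i) ≡ true) →
  (j : Fin k) →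
  (Σ Elt (λ G → (∀ r → coord P G r ≡ nth (sortℕ (map (λ i → coord P (M i) r) (allFin k))) (toℕ j)) × B G ≡ true))
  × (∀ G → (∀ r → coord P G r ≡ nth (sortℕ (map (λ i → coord P (M i) r) (allFin k))) (toℕ j)) → B G ≡ true)
theorem2 L n P B regular k M _ B-M j = conclude (realise Ms (map⁺ (tabulate⁺ B-M)) (toℕ j) j<length)
  where
  open FDL L
  open LatticeFacts L using (module Coordinates)
  open Coordinates P using (coord-∨; coord-∧; coord-injective)
  open OrderStatistics _∨_ _∧_ (coord P) coord-∨ coord-∧ (λ G → B G ≡ true)
         (λ BG BH → proj₁ (regular _ _ BG BH)) (λ BG BH → proj₂ (regular _ _ BG BH))

  Ms : List Elt
  Ms = map M (allFin k)

  j<length : toℕ j < length Ms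
  j<length = subst (toℕ j <_) (sym (trans (length-map M (allFin k)) (length-tabulate id))) (toℕ<n j)

  Required : Elt → Set
  Required G = ∀ r → coord P G r ≡ nth (sortℕ (map (λ i → coord P (M i) r) (allFin k))) (toℕ j)

  stat-Ms : ∀ r → stat Ms (toℕ j) r ≡ nth (sortℕ (map (λ i → coord P (M i) r) (allFin k))) (toℕ j)
  stat-Ms r = cong (λ l → nth (sortℕ l) (toℕ j)) (sym (map-∘ (allFin k)))

  conclude : Σ Elt (Realises Ms (toℕ j)) →
             Σ Elt (λ G → Required G × B G ≡ true) × (∀ G → Required G → B G ≡ true)
  conclude (G , BG , G-stat) = (G , G-required , BG) , λ G′ G′-required →
    subst (λ z → B z ≡ true) (sym (coord-injective (λ r → trans (G′-required r) (sym (G-required r))))) BG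
    where
    G-required : Required G
    G-required r = trans (G-stat r) (stat-Ms r)
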